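{- Let $X$ be a complete $k$-ary tree of depth $d$ with binary labels on its non-root nodes; let $b_{\ell,i}$ be the label of the $i$-th node from the left (indexing from $0$) on level $\ell$ of $X$. Let $Y$ be the augmented trace of an AON trace of $X$ with deletion probability $q$, and let $a_{\ell,i}$ be the label of the $i$-th node from the left on level $\ell$ of $Y$. Writing $i=t_{\ell-1}k^{\ell-1}+\dots+t_0$ in base $k$ and abbreviating $a_{\ell,i}=a_{\ell,t_{\ell-1}\ldots t_0}$, $b_{\ell,i}=b_{\ell,t_{\ell-1}\ldots t_0}$, define $$A_\ell(w) := \sum_{t_0=0}^{k-1}\cdots\sum_{t_{\ell-1}=0}^{k-1} a_{\ell,t_{\ell-1}\ldots t_0}\,w_{\ell-1}^{t_{\ell-1}}\cdots w_0^{t_0}.$$ Then for every $\ell\in\{1,\dots,d\}$, $$\mathbb{E}[A_\ell(w)] = (1-q)^{\ell}\sum_{t_0=0}^{k-1}\cdots\sum_{t_{\ell-1}=0}^{k-1} b_{\ell,t_{\ell-1}\ldots t_0}\prod_{m=0}^{\ell-1}\big((1-q)w_m+q\big)^{t_m}.$$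
   Context: AON (All-Or-Nothing) deletion model with parameter $q$: each non-root node is marked independently with probability $q$; a node is deleted iff it is marked or has a marked ancestor; the root is never deleted; the surviving labeled ordered tree is the trace. The augmented trace is obtained from the trace by processing nodes level by level from top to bottom and, within each level, left to right: each node on levels $0,\dots,d-1$ with fewer than $k$ children receives new children labeled $0$ appended to the right of its existing children until it has $k$ children, so the augmented trace is a complete $k$-ary tree of depth $d$. The expectation is over the random trace. -}

module Defs where

open import Level using (Level)
open import Data.Bool using (Bool; true; false; if_then_else_)
open import Data.Nat using (ℕ; zero; suc; _∸_)
import Data.Nat as N
open import Data.List using (List; []; _∷_; _++_; map; concatMap; replicate; length)
open import Data.List.Relation.Unary.All using (All)
open import Data.Fin using (Fin; toℕ)
open import Data.List using (allFin)
open import Data.Vec using (Vec; []; _∷_)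
open import Relation.Binary.PropositionalEquality using (_≡_)
open import Algebra.Bundles using (CommutativeRing)

-- Labelled ordered (rose) trees with binary labels.
-- Label `false` = 0, `true` = 1.  The root label is irrelevant.

data Tree : Set where
  node : Bool → List Tree → Tree

data IsComplete (k : ℕ) : ℕ → Tree → Set where
  leaf  : ∀ l → IsComplete k 0 (node l [])
  inner : ∀ {d l cs} → length cs ≡ k → All (IsComplete k d) cs →
          IsComplete k (suc d) (node l cs)

mutual
  level : ℕ → Tree → List Bool
  level zero    (node l cs) = l ∷ []
  level (suc n) (node l cs) = levelL n cs

  levelL : ℕ → List Tree → List Bool
  levelL n []       = []
  levelL n (c ∷ cs) = level n c ++ levelL n cs

nth : List Bool → ℕ → Bool
nth []       _       = false
nth (x ∷ xs) zero    = x
nth (x ∷ xs) (suc i) = nth xs i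

lab : Tree → ℕ → ℕ → Bool
lab T ℓ i = nth (level ℓ T) i

-- Markings.  A marking of X is a tree of the same shape whose labels are
-- the marks (true = marked).  The root is never marked.

mutual
  allMarks : Tree → List Tree
  allMarks (node _ cs) =
    concatMap (λ b → map (node b) (allMarksL cs)) (false ∷ true ∷ [])

  allMarksL : List Tree → List (List Tree)
  allMarksL []       = [] ∷ []
  allMarksL (c ∷ cs) =
    concatMap (λ m → map (m ∷_) (allMarksL cs)) (allMarks c)

markings : Tree → List Tree
markings (node _ cs) = map (node false) (allMarksL cs)

-- AON trace: a node is deleted iff it or an ancestor is marked.
mutual
  trace : Tree → Tree → Tree
  trace (node l cs) (node _ ms) = node l (traceL cs ms)

  traceL : List Tree → List Tree → List Tree
  traceL []       _  = []
  traceL (c ∷ cs) [] = []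
  traceL (c ∷ cs) (node true  ms ∷ mss) = traceL cs mss
  traceL (c ∷ cs) (node false ms ∷ mss) = trace c (node false ms) ∷ traceL cs mss

-- Augmented trace: pad to a complete k-ary tree of depth d with 0-labels,
-- new children appended to the right of existing ones.

zeroTree : ℕ → ℕ → Tree
zeroTree k zero    = node false []
zeroTree k (suc d) = node false (replicate k (zeroTree k d))

mutual
  augment : ℕ → ℕ → Tree → Tree
  augment k zero    t           = t
  augment k (suc d) (node l cs) =
    node l (augmentL k d cs ++ replicate (k ∸ length cs) (zeroTree k d))

  augmentL : ℕ → ℕ → List Tree → List Tree
  augmentL k d []       = []
  augmentL k d (c ∷ cs) = augment k d c ∷ augmentL k d cs

tuples : (k ℓ : ℕ) → List (Vec (Fin k) ℓ)
tuples k zero    = [] ∷ []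
tuples k (suc ℓ) = concatMap (λ x → map (x ∷_) (tuples k ℓ)) (allFin k)

index : ∀ {k ℓ} → Vec (Fin k) ℓ → ℕ
index         []      = 0
index {k} (x ∷ t) = toℕ x N.+ k N.* index t

-- Ring-valued quantities (a polynomial identity; stated over any
-- commutative ring, in particular ℝ).

module WithRing {c r : Level} (R : CommutativeRing c r) where
  open CommutativeRing R

  pow : Carrier → ℕ → Carrier
  pow x zero    = 1#
  pow x (suc n) = x * pow x n

  sumR : List Carrier → Carrier
  sumR []       = 0#
  sumR (x ∷ xs) = x + sumR xs

  bit : Bool → Carrier
  bit b = if b then 1# else 0#

  monoWith : ∀ {k ℓ} → (Carrier → Carrier) → Vec Carrier ℓ → Vec (Fin k) ℓ → Carrier
  monoWith f []       []       = 1#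
  monoWith f (w ∷ ws) (t ∷ ts) = pow (f w) (toℕ t) * monoWith f ws ts

  Apoly : (k ℓ : ℕ) → Tree → Vec Carrier ℓ → Carrier
  Apoly k ℓ Y w = sumR (map (λ t → bit (lab Y ℓ (index t)) * monoWith (λ x → x) w t)
                            (tuples k ℓ))

  weightL : Carrier → List Tree → Carrier
  weightL q []                   = 1#
  weightL q (node b ms ∷ mss) =
    (if b then q else (1# - q)) * (weightL q ms * weightL q mss)

  weight : Carrier → Tree → Carrier
  weight q (node _ ms) = weightL q ms

  E : Carrier → Tree → (Tree → Carrier) → Carrier
  E q X f = sumR (map (λ m → weight q m * f (trace X m)) (markings X))

-- Write the level-ℓ polynomial in Horner form from the root down: a node with
-- children c₀ … c_{n-1} contributes Σᵢ uⁱ Vᵢ, where Vᵢ is the value of cᵢ and u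
-- the variable of the node's level.  A child is kept with probability p = 1 - q, and deleting it shifts
-- every later sibling one place to the left.  Conditioning on the fate of the
-- first child therefore gives E[Σᵢ uⁱ Vᵢ] = p·E[V₀] + (p u + q)·E[Σᵢ uⁱ Vᵢ₊₁],
-- so by induction every variable u is replaced by p u + q and every level
-- contributes a factor p.  The zero padding of the augmentation contributes
-- nothing, and on a complete k-ary tree the Horner form is the digit sum Aℓ.
module Submission where

open import Defs
open import Data.Bool using (Bool; true; false)
open import Data.Nat using (ℕ; zero; suc; _≤_; _<_; _∸_; z≤n; s≤s)
import Data.Nat as N
import Data.Nat.Properties as NP
open import Data.Nat.Solver using (module +-*-Solver)
open import Data.Fin using (Fin; toℕ) renaming (zero to fzero; suc to fsuc)
open import Data.Fin.Properties using (toℕ<n)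
open import Data.List using (List; []; _∷_; _++_; map; concat; concatMap; replicate; length; allFin)
import Data.List.Properties as LP
open import Data.List.Relation.Unary.All using (All; []; _∷_)
import Data.List.Relation.Unary.All.Properties as AllP
open import Data.Vec using (Vec; []; _∷_; _∷ʳ_; reverse)
import Data.Vec as V
open import Data.Vec.Properties using (reverse-∷; map-reverse)
open import Function using (_∘_)
open import Relation.Binary.PropositionalEquality as ≡ using (_≡_)
open import Algebra.Bundles using (CommutativeRing)

private
  variable
    A B : Set

zeroLeaf : Tree
zeroLeaf = node false []

root : Tree → Bool
root (node l _) = l

children : Tree → List Tree
children (node _ cs) = cs

nthOr : A → List A → ℕ → A
nthOr d []       i       = d
nthOr d (x ∷ xs) zero    = x
nthOr d (x ∷ xs) (suc i) = nthOr d xs i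

nth≡nthOr : ∀ xs i → nth xs i ≡ nthOr false xs i
nth≡nthOr []       i       = ≡.refl
nth≡nthOr (x ∷ xs) zero    = ≡.refl
nth≡nthOr (x ∷ xs) (suc i) = nth≡nthOr xs i

nthOr-map : ∀ (f : A → B) d xs i → nthOr (f d) (map f xs) i ≡ f (nthOr d xs i)
nthOr-map f d []       i       = ≡.refl
nthOr-map f d (x ∷ xs) zero    = ≡.refl
nthOr-map f d (x ∷ xs) (suc i) = nthOr-map f d xs i

nthOr-++ˡ : ∀ (d : A) xs ys {i} → i < length xs → nthOr d (xs ++ ys) i ≡ nthOr d xs i
nthOr-++ˡ d (x ∷ xs) ys {zero}  _         = ≡.refl
nthOr-++ˡ d (x ∷ xs) ys {suc i} (s≤s i<n) = nthOr-++ˡ d xs ys i<n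

nthOr-++ʳ : ∀ (d : A) xs ys j → nthOr d (xs ++ ys) (length xs N.+ j) ≡ nthOr d ys j
nthOr-++ʳ d []       ys j = ≡.refl
nthOr-++ʳ d (x ∷ xs) ys j = nthOr-++ʳ d xs ys j

nthOr-concat : ∀ {k x} (d : A) xss i → All (λ xs → length xs ≡ k) xss → x < k →
               nthOr d (concat xss) (x N.+ k N.* i) ≡ nthOr d (nthOr [] xss i) x
nthOr-concat d []         i       _          _   = ≡.refl
nthOr-concat {x = x} d (xs ∷ xss) zero (≡.refl ∷ _) x<k =
  ≡.trans (≡.cong (nthOr d (xs ++ concat xss)) (x+k*0≡x x (length xs)))
          (nthOr-++ˡ d xs (concat xss) x<k)
  where
  open +-*-Solver
  x+k*0≡x : ∀ x k → x N.+ k N.* 0 ≡ x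
  x+k*0≡x = solve 2 (λ x k → x :+ k :* con 0 := x) ≡.refl
nthOr-concat {x = x} d (xs ∷ xss) (suc i) (≡.refl ∷ ls) x<k =
  ≡.trans (≡.cong (nthOr d (xs ++ concat xss)) (skip-block x (length xs) i))
  (≡.trans (nthOr-++ʳ d xs (concat xss) (x N.+ length xs N.* i))
           (nthOr-concat d xss i ls x<k))
  where
  open +-*-Solver
  skip-block : ∀ x k i → x N.+ k N.* suc i ≡ k N.+ (x N.+ k N.* i)
  skip-block = solve 3 (λ x k i → x :+ k :* (con 1 :+ i) := k :+ (x :+ k :* i)) ≡.refl

mutual
  nodesAt : ℕ → Tree → List Tree
  nodesAt zero    T           = T ∷ []
  nodesAt (suc n) (node _ cs) = nodesAtL n cs

  nodesAtL : ℕ → List Tree → List Tree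
  nodesAtL n []       = []
  nodesAtL n (c ∷ cs) = nodesAt n c ++ nodesAtL n cs

mutual
  level≡map-root : ∀ n T → level n T ≡ map root (nodesAt n T)
  level≡map-root zero    (node l cs) = ≡.refl
  level≡map-root (suc n) (node l cs) = levelL≡map-root n cs

  levelL≡map-root : ∀ n cs → levelL n cs ≡ map root (nodesAtL n cs)
  levelL≡map-root n []       = ≡.refl
  levelL≡map-root n (c ∷ cs) =
    ≡.trans (≡.cong₂ _++_ (level≡map-root n c) (levelL≡map-root n cs))
            (≡.sym (LP.map-++ root (nodesAt n c) (nodesAtL n cs)))

lab≡root-nthOr : ∀ T ℓ i → lab T ℓ i ≡ root (nthOr zeroLeaf (nodesAt ℓ T) i)
lab≡root-nthOr T ℓ i = begin
  nth (level ℓ T) i                      ≡⟨ ≡.cong (λ xs → nth xs i) (level≡map-root ℓ T) ⟩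
  nth (map root (nodesAt ℓ T)) i         ≡⟨ nth≡nthOr (map root (nodesAt ℓ T)) i ⟩
  nthOr false (map root (nodesAt ℓ T)) i ≡⟨ nthOr-map root zeroLeaf (nodesAt ℓ T) i ⟩
  root (nthOr zeroLeaf (nodesAt ℓ T) i)      ∎
  where open ≡.≡-Reasoning

nodesAtL-zero : ∀ cs → nodesAtL 0 cs ≡ cs
nodesAtL-zero []       = ≡.refl
nodesAtL-zero (c ∷ cs) = ≡.cong (c ∷_) (nodesAtL-zero cs)

mutual
  nodesAt-suc : ∀ n T → nodesAt (suc n) T ≡ concatMap children (nodesAt n T)
  nodesAt-suc zero    (node l cs) = ≡.trans (nodesAtL-zero cs) (≡.sym (LP.++-identityʳ cs))
  nodesAt-suc (suc n) (node l cs) = nodesAtL-suc n cs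

  nodesAtL-suc : ∀ n cs → nodesAtL (suc n) cs ≡ concatMap children (nodesAtL n cs)
  nodesAtL-suc n []       = ≡.refl
  nodesAtL-suc n (c ∷ cs) =
    ≡.trans (≡.cong₂ _++_ (nodesAt-suc n c) (nodesAtL-suc n cs))
            (≡.sym (LP.concatMap-++ children (nodesAt n c) (nodesAtL n cs)))

nthOr-nodesAt-suc : ∀ {k} ℓ T {x} i → All (λ N → length (children N) ≡ k) (nodesAt ℓ T) → x < k →
                    nthOr zeroLeaf (nodesAt (suc ℓ) T) (x N.+ k N.* i)
                      ≡ nthOr zeroLeaf (children (nthOr zeroLeaf (nodesAt ℓ T) i)) x
nthOr-nodesAt-suc ℓ T {x} i full x<k = begin
  nthOr zeroLeaf (nodesAt (suc ℓ) T) _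
    ≡⟨ ≡.cong (λ Ns → nthOr zeroLeaf Ns _) (nodesAt-suc ℓ T) ⟩
  nthOr zeroLeaf (concat (map children (nodesAt ℓ T))) _
    ≡⟨ nthOr-concat zeroLeaf (map children (nodesAt ℓ T)) i (AllP.map⁺ full) x<k ⟩
  nthOr zeroLeaf (nthOr [] (map children (nodesAt ℓ T)) i) x
    ≡⟨ ≡.cong (λ cs → nthOr zeroLeaf cs x) (nthOr-map children zeroLeaf (nodesAt ℓ T) i) ⟩
  nthOr zeroLeaf (children (nthOr zeroLeaf (nodesAt ℓ T) i)) x ∎
  where open ≡.≡-Reasoning

data Saturated (k : ℕ) : ℕ → Tree → Set where
  sat-zero : ∀ T → Saturated k 0 T
  sat-suc  : ∀ {ℓ l cs} → length cs ≡ k → All (Saturated k ℓ) cs → Saturated k (suc ℓ) (node l cs)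

data Bounded (k : ℕ) : ℕ → Tree → Set where
  bnd-zero : ∀ T → Bounded k 0 T
  bnd-suc  : ∀ {d l cs} → length cs ≤ k → All (Bounded k d) cs → Bounded k (suc d) (node l cs)

module _ {k : ℕ} where

  mutual
    saturated-≤ : ∀ {ℓ d T} → ℓ ≤ d → Saturated k d T → Saturated k ℓ T
    saturated-≤ z≤n      _               = sat-zero _
    saturated-≤ (s≤s le) (sat-suc len s) = sat-suc len (saturatedL-≤ le s)

    saturatedL-≤ : ∀ {ℓ d cs} → ℓ ≤ d → All (Saturated k d) cs → All (Saturated k ℓ) cs
    saturatedL-≤ le []       = []
    saturatedL-≤ le (s ∷ ss) = saturated-≤ le s ∷ saturatedL-≤ le ss

  mutual
    saturated-nodesAt : ∀ {ℓ T} → Saturated k (suc ℓ) T → All (λ N → length (children N) ≡ k) (nodesAt ℓ T)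
    saturated-nodesAt {zero}  (sat-suc len _) = len ∷ []
    saturated-nodesAt {suc ℓ} (sat-suc _ ss)  = saturatedL-nodesAtL ss

    saturatedL-nodesAtL : ∀ {ℓ cs} → All (Saturated k (suc ℓ)) cs →
                          All (λ N → length (children N) ≡ k) (nodesAtL ℓ cs)
    saturatedL-nodesAtL []       = []
    saturatedL-nodesAtL (s ∷ ss) = AllP.++⁺ (saturated-nodesAt s) (saturatedL-nodesAtL ss)

  mutual
    complete⇒saturated : ∀ {d X} → IsComplete k d X → Saturated k d X
    complete⇒saturated (leaf _)      = sat-zero _
    complete⇒saturated (inner len a) = sat-suc len (completeL⇒saturatedL a)

    completeL⇒saturatedL : ∀ {d cs} → All (IsComplete k d) cs → All (Saturated k d) cs
    completeL⇒saturatedL []       = []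
    completeL⇒saturatedL (a ∷ as) = complete⇒saturated a ∷ completeL⇒saturatedL as

  length-traceL : ∀ cs ms → length (traceL cs ms) ≤ length cs
  length-traceL []       ms                     = z≤n
  length-traceL (c ∷ cs) []                     = z≤n
  length-traceL (c ∷ cs) (node true  ms ∷ mss) = NP.m≤n⇒m≤1+n (length-traceL cs mss)
  length-traceL (c ∷ cs) (node false ms ∷ mss) = s≤s (length-traceL cs mss)

  mutual
    trace-bounded : ∀ {d X} m → IsComplete k d X → Bounded k d (trace X m)
    trace-bounded m (leaf _) = bnd-zero _
    trace-bounded {X = node l cs} (node _ ms) (inner len a) =
      bnd-suc (≡.subst (length (traceL cs ms) ≤_) len (length-traceL cs ms)) (traceL-bounded ms a)

    traceL-bounded : ∀ {d cs} ms → All (IsComplete k d) cs → All (Bounded k d) (traceL cs ms)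
    traceL-bounded                 ms                     []       = []
    traceL-bounded                 []                     (a ∷ as) = []
    traceL-bounded                 (node true  ms ∷ mss) (a ∷ as) = traceL-bounded mss as
    traceL-bounded {cs = c ∷ _}    (node false ms ∷ mss) (a ∷ as) =
      trace-bounded (node false ms) a ∷ traceL-bounded mss as

  zeroTree-saturated : ∀ d → Saturated k d (zeroTree k d)
  zeroTree-saturated zero    = sat-zero _
  zeroTree-saturated (suc d) = sat-suc (LP.length-replicate k) (AllP.replicate⁺ k (zeroTree-saturated d))

  length-augmentL : ∀ d cs → length (augmentL k d cs) ≡ length cs
  length-augmentL d []       = ≡.refl
  length-augmentL d (c ∷ cs) = ≡.cong suc (length-augmentL d cs)

  mutual
    augment-saturated : ∀ {d T} → Bounded k d T → Saturated k d (augment k d T)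
    augment-saturated (bnd-zero T) = sat-zero T
    augment-saturated {suc d} {node l cs} (bnd-suc len≤k bs) =
      sat-suc padded-length
              (AllP.++⁺ (augmentL-saturated bs) (AllP.replicate⁺ (k ∸ length cs) (zeroTree-saturated d)))
      where
      padded-length : length (augmentL k d cs ++ replicate (k ∸ length cs) (zeroTree k d)) ≡ k
      padded-length = begin
        length (augmentL k d cs ++ replicate (k ∸ length cs) (zeroTree k d))
          ≡⟨ LP.length-++ (augmentL k d cs) ⟩
        length (augmentL k d cs) N.+ length (replicate (k ∸ length cs) (zeroTree k d))
          ≡⟨ ≡.cong₂ N._+_ (length-augmentL d cs) (LP.length-replicate (k ∸ length cs)) ⟩
        length cs N.+ (k ∸ length cs)
          ≡⟨ NP.m+[n∸m]≡n len≤k ⟩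
        k ∎
        where open ≡.≡-Reasoning

    augmentL-saturated : ∀ {d cs} → All (Bounded k d) cs → All (Saturated k d) (augmentL k d cs)
    augmentL-saturated []       = []
    augmentL-saturated (b ∷ bs) = augment-saturated b ∷ augmentL-saturated bs

root-augment : ∀ k d l ts → root (augment k d (node l ts)) ≡ l
root-augment k zero    l ts = ≡.refl
root-augment k (suc d) l ts = ≡.refl

module Evaluation {c r} (R : CommutativeRing c r) where
  open CommutativeRing R
  open WithRing R
  open import Relation.Binary.Reasoning.Setoid setoid
  open import Algebra.Solver.Ring.NaturalCoefficients.Default commutativeSemiring

  ∑ : List A → (A → Carrier) → Carrier
  ∑ xs f = sumR (map f xs)

  syntax ∑ xs (λ x → e) = ∑[ x ∈ xs ] e

  ∑-cong : ∀ (xs : List A) {f g : A → Carrier} → (∀ x → f x ≈ g x) → ∑ xs f ≈ ∑ xs g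
  ∑-cong []       e = refl
  ∑-cong (x ∷ xs) e = +-cong (e x) (∑-cong xs e)

  ∑-zero : ∀ (xs : List A) → ∑[ x ∈ xs ] 0# ≈ 0#
  ∑-zero []       = refl
  ∑-zero (x ∷ xs) = trans (+-identityˡ _) (∑-zero xs)

  ∑-+ : ∀ (xs : List A) (f g : A → Carrier) → ∑[ x ∈ xs ] (f x + g x) ≈ ∑ xs f + ∑ xs g
  ∑-+ []       f g = sym (+-identityˡ 0#)
  ∑-+ (x ∷ xs) f g = trans (+-congˡ (∑-+ xs f g))
    (solve 4 (λ a b c d → (a :+ b) :+ (c :+ d) := (a :+ c) :+ (b :+ d)) refl (f x) (g x) (∑ xs f) (∑ xs g))

  ∑-*ˡ : ∀ (xs : List A) a (f : A → Carrier) → ∑[ x ∈ xs ] (a * f x) ≈ a * ∑ xs f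
  ∑-*ˡ []       a f = sym (zeroʳ a)
  ∑-*ˡ (x ∷ xs) a f = trans (+-congˡ (∑-*ˡ xs a f)) (sym (distribˡ a (f x) (∑ xs f)))

  ∑-*ʳ : ∀ (xs : List A) a (f : A → Carrier) → ∑[ x ∈ xs ] (f x * a) ≈ ∑ xs f * a
  ∑-*ʳ xs a f = trans (∑-cong xs (λ x → *-comm (f x) a)) (trans (∑-*ˡ xs a f) (*-comm a _))

  ∑-++ : ∀ (xs ys : List A) (f : A → Carrier) → ∑ (xs ++ ys) f ≈ ∑ xs f + ∑ ys f
  ∑-++ []       ys f = sym (+-identityˡ _)
  ∑-++ (x ∷ xs) ys f = trans (+-congˡ (∑-++ xs ys f)) (sym (+-assoc _ _ _))

  ∑-map : ∀ (xs : List A) (h : A → B) (f : B → Carrier) → ∑ (map h xs) f ≡ ∑ xs (f ∘ h)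
  ∑-map xs h f = ≡.cong sumR (≡.sym (LP.map-∘ xs))

  ∑-concatMap-map : ∀ {C : Set} (xs : List A) (ys : List B) (h : A → B → C) (f : C → Carrier) →
                    ∑ (concatMap (λ x → map (h x) ys) xs) f ≈ ∑[ x ∈ xs ] ∑[ y ∈ ys ] f (h x y)
  ∑-concatMap-map []       ys h f = refl
  ∑-concatMap-map (x ∷ xs) ys h f =
    trans (∑-++ (map (h x) ys) _ f)
          (+-cong (reflexive (∑-map ys (h x) f)) (∑-concatMap-map xs ys h f))

  ∑-swap : ∀ (xs : List A) (ys : List B) (f : A → B → Carrier) →
           ∑[ x ∈ xs ] ∑[ y ∈ ys ] f x y ≈ ∑[ y ∈ ys ] ∑[ x ∈ xs ] f x y
  ∑-swap []       ys f = sym (∑-zero ys)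
  ∑-swap (x ∷ xs) ys f = trans (+-congˡ (∑-swap xs ys f)) (sym (∑-+ ys (f x) _))

  ∑-allFin-suc : ∀ n (f : Fin (suc n) → Carrier) → ∑ (allFin (suc n)) f ≈ f fzero + ∑ (allFin n) (f ∘ fsuc)
  ∑-allFin-suc n f = reflexive (≡.trans (≡.cong sumR (LP.map-tabulate (λ x → x) f))
                       (≡.cong (λ xs → f fzero + sumR xs) (≡.sym (LP.map-tabulate (λ x → x) (f ∘ fsuc)))))

  monoWith-map : ∀ {k ℓ} (f : Carrier → Carrier) (w : Vec Carrier ℓ) (t : Vec (Fin k) ℓ) →
                 monoWith f w t ≡ monoWith (λ x → x) (V.map f w) t
  monoWith-map f []      []      = ≡.refl
  monoWith-map f (x ∷ w) (y ∷ t) = ≡.cong (pow (f x) (toℕ y) *_) (monoWith-map f w t)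

  rootBit : Tree → Carrier
  rootBit = bit ∘ root

  -- The variable of the top level comes first: the reverse of the order in Apoly.
  mutual
    horner : (ℓ : ℕ) → (Tree → Carrier) → Tree → Vec Carrier ℓ → Carrier
    horner zero    g T           []       = g T
    horner (suc ℓ) g (node _ cs) (u ∷ us) = hornerL ℓ g cs u us

    hornerL : (ℓ : ℕ) → (Tree → Carrier) → List Tree → Carrier → Vec Carrier ℓ → Carrier
    hornerL ℓ g []       u us = 0#
    hornerL ℓ g (c ∷ cs) u us = horner ℓ g c us + u * hornerL ℓ g cs u us

  hornerL-powerSum : ∀ g cs u → hornerL 0 g cs u [] ≈ ∑[ x ∈ allFin (length cs) ] (pow u (toℕ x) * g (nthOr zeroLeaf cs (toℕ x)))
  hornerL-powerSum g []       u = refl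
  hornerL-powerSum g (c ∷ cs) u = sym (begin
    ∑[ x ∈ allFin (suc (length cs)) ] (pow u (toℕ x) * g (nthOr zeroLeaf (c ∷ cs) (toℕ x)))
      ≈⟨ ∑-allFin-suc (length cs) _ ⟩
    1# * g c + ∑[ x ∈ allFin (length cs) ] ((u * pow u (toℕ x)) * g (nthOr zeroLeaf cs (toℕ x)))
      ≈⟨ +-cong (*-identityˡ (g c)) (∑-cong (allFin (length cs)) (λ x → *-assoc u _ _)) ⟩
    g c + ∑[ x ∈ allFin (length cs) ] (u * (pow u (toℕ x) * g (nthOr zeroLeaf cs (toℕ x))))
      ≈⟨ +-congˡ (∑-*ˡ (allFin (length cs)) u _) ⟩
    g c + u * ∑[ x ∈ allFin (length cs) ] (pow u (toℕ x) * g (nthOr zeroLeaf cs (toℕ x)))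
      ≈⟨ +-congˡ (*-congˡ (sym (hornerL-powerSum g cs u))) ⟩
    hornerL 0 g (c ∷ cs) u [] ∎)

  module _ (k : ℕ) where

    childSum : Carrier → (Tree → Carrier) → Tree → Carrier
    childSum u g N = ∑[ x ∈ allFin k ] (pow u (toℕ x) * g (nthOr zeroLeaf (children N) (toℕ x)))

    digitSum : (ℓ : ℕ) → (Tree → Carrier) → Tree → Vec Carrier ℓ → Carrier
    digitSum ℓ g T w = ∑[ t ∈ tuples k ℓ ] (g (nthOr zeroLeaf (nodesAt ℓ T) (index t)) * monoWith (λ x → x) w t)

    Apoly≈digitSum : ∀ ℓ Y (w : Vec Carrier ℓ) → Apoly k ℓ Y w ≈ digitSum ℓ rootBit Y w
    Apoly≈digitSum ℓ Y w = ∑-cong (tuples k ℓ) (λ t →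
      reflexive (≡.cong (λ b → bit b * monoWith (λ x → x) w t) (lab≡root-nthOr Y ℓ (index t))))

    -- Summing out the lowest digit t₀ collapses the bottom level into its parents.
    digitSum-suc : ∀ ℓ g T w₀ (ws : Vec Carrier ℓ) → All (λ N → length (children N) ≡ k) (nodesAt ℓ T) →
                   digitSum (suc ℓ) g T (w₀ ∷ ws) ≈ digitSum ℓ (childSum w₀ g) T ws
    digitSum-suc ℓ g T w₀ ws full = begin
      digitSum (suc ℓ) g T (w₀ ∷ ws)
        ≈⟨ ∑-concatMap-map (allFin k) (tuples k ℓ) _∷_ _ ⟩
      ∑[ x ∈ allFin k ] ∑[ t ∈ tuples k ℓ ] (g (nodeOf (x ∷ t)) * (pow w₀ (toℕ x) * monoWith (λ y → y) ws t))
        ≈⟨ ∑-cong (allFin k) (λ x → ∑-cong (tuples k ℓ) (λ t → regroup x t)) ⟩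
      ∑[ x ∈ allFin k ] ∑[ t ∈ tuples k ℓ ] (child x t * monoWith (λ y → y) ws t)
        ≈⟨ ∑-swap (allFin k) (tuples k ℓ) _ ⟩
      ∑[ t ∈ tuples k ℓ ] ∑[ x ∈ allFin k ] (child x t * monoWith (λ y → y) ws t)
        ≈⟨ ∑-cong (tuples k ℓ) (λ t → ∑-*ʳ (allFin k) _ (λ x → child x t)) ⟩
      digitSum ℓ (childSum w₀ g) T ws ∎
      where
      nodeOf : ∀ {n} → Vec (Fin k) n → Tree
      nodeOf {n} t = nthOr zeroLeaf (nodesAt n T) (index t)
      child : Fin k → Vec (Fin k) ℓ → Carrier
      child x t = pow w₀ (toℕ x) * g (nthOr zeroLeaf (children (nodeOf t)) (toℕ x))
      regroup : ∀ x t → g (nodeOf (x ∷ t)) * (pow w₀ (toℕ x) * monoWith (λ y → y) ws t)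
                        ≈ child x t * monoWith (λ y → y) ws t
      regroup x t = trans
        (*-congʳ (reflexive (≡.cong g (nthOr-nodesAt-suc ℓ T (index t) full (toℕ<n x)))))
        (solve 3 (λ a b m → a :* (b :* m) := (b :* a) :* m) refl _ _ _)

    mutual
      horner-∷ʳ : ∀ ℓ g T (us : Vec Carrier ℓ) u → Saturated k (suc ℓ) T →
                  horner (suc ℓ) g T (us ∷ʳ u) ≈ horner ℓ (childSum u g) T us
      horner-∷ʳ zero g (node l cs) [] u (sat-suc len _) =
        ≡.subst (λ n → hornerL 0 g cs u [] ≈ ∑[ x ∈ allFin n ] (pow u (toℕ x) * g (nthOr zeroLeaf cs (toℕ x))))
                len (hornerL-powerSum g cs u)
      horner-∷ʳ (suc ℓ) g (node l cs) (u₁ ∷ us) u (sat-suc _ ss) = hornerL-∷ʳ ℓ g cs us u u₁ ss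

      hornerL-∷ʳ : ∀ ℓ g cs (us : Vec Carrier ℓ) u u₁ → All (Saturated k (suc ℓ)) cs →
                   hornerL (suc ℓ) g cs u₁ (us ∷ʳ u) ≈ hornerL ℓ (childSum u g) cs u₁ us
      hornerL-∷ʳ ℓ g []       us u u₁ []       = refl
      hornerL-∷ʳ ℓ g (c ∷ cs) us u u₁ (s ∷ ss) = +-cong (horner-∷ʳ ℓ g c us u s) (*-congˡ (hornerL-∷ʳ ℓ g cs us u u₁ ss))

    digitSum≈horner : ∀ ℓ g T (w : Vec Carrier ℓ) → Saturated k ℓ T → digitSum ℓ g T w ≈ horner ℓ g T (reverse w)
    digitSum≈horner zero    g T []         _   = trans (+-identityʳ _) (*-identityʳ _)
    digitSum≈horner (suc ℓ) g T (w₀ ∷ ws) sat = begin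
      digitSum (suc ℓ) g T (w₀ ∷ ws)
        ≈⟨ digitSum-suc ℓ g T w₀ ws (saturated-nodesAt sat) ⟩
      digitSum ℓ (childSum w₀ g) T ws
        ≈⟨ digitSum≈horner ℓ (childSum w₀ g) T ws (saturated-≤ (NP.n≤1+n ℓ) sat) ⟩
      horner ℓ (childSum w₀ g) T (reverse ws)
        ≈⟨ sym (horner-∷ʳ ℓ g T (reverse ws) w₀ sat) ⟩
      horner (suc ℓ) g T (reverse ws ∷ʳ w₀)
        ≡⟨ ≡.cong (horner (suc ℓ) g T) (≡.sym (reverse-∷ w₀ ws)) ⟩
      horner (suc ℓ) g T (reverse (w₀ ∷ ws)) ∎

    Apoly≈horner : ∀ ℓ Y (w : Vec Carrier ℓ) → Saturated k ℓ Y → Apoly k ℓ Y w ≈ horner ℓ rootBit Y (reverse w)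
    Apoly≈horner ℓ Y w sat = trans (Apoly≈digitSum ℓ Y w) (digitSum≈horner ℓ rootBit Y w sat)

    mutual
      horner-zeroTree : ∀ ℓ d (us : Vec Carrier ℓ) → horner ℓ rootBit (zeroTree k d) us ≈ 0#
      horner-zeroTree zero    zero    []       = refl
      horner-zeroTree zero    (suc d) []       = refl
      horner-zeroTree (suc ℓ) zero    (u ∷ us) = refl
      horner-zeroTree (suc ℓ) (suc d) (u ∷ us) = hornerL-zeroTrees ℓ d k u us

      hornerL-zeroTrees : ∀ ℓ d n u (us : Vec Carrier ℓ) → hornerL ℓ rootBit (replicate n (zeroTree k d)) u us ≈ 0#
      hornerL-zeroTrees ℓ d zero    u us = refl
      hornerL-zeroTrees ℓ d (suc n) u us =
        trans (+-cong (horner-zeroTree ℓ d us) (*-congˡ (hornerL-zeroTrees ℓ d n u us)))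
              (solve 1 (λ a → con 0 :+ a :* con 0 := con 0) refl u)

    hornerL-padding : ∀ ℓ d xs n u (us : Vec Carrier ℓ) →
                      hornerL ℓ rootBit (xs ++ replicate n (zeroTree k d)) u us ≈ hornerL ℓ rootBit xs u us
    hornerL-padding ℓ d []       n u us = hornerL-zeroTrees ℓ d n u us
    hornerL-padding ℓ d (x ∷ xs) n u us = +-congˡ (*-congˡ (hornerL-padding ℓ d xs n u us))

  module _ (q : Carrier) where

    p : Carrier
    p = 1# - q

    p+q≈1 : p + q ≈ 1#
    p+q≈1 = trans (+-assoc 1# (- q) q) (trans (+-congˡ (-‿inverseˡ q)) (+-identityʳ 1#))

    𝔼 : List Tree → (List Tree → Carrier) → Carrier
    𝔼 cs f = ∑[ ms ∈ allMarksL cs ] (weightL q ms * f ms)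

    𝔼-cong : ∀ cs {f g : List Tree → Carrier} → (∀ ms → f ms ≈ g ms) → 𝔼 cs f ≈ 𝔼 cs g
    𝔼-cong cs e = ∑-cong (allMarksL cs) (λ ms → *-congˡ (e ms))

    𝔼-+ : ∀ cs f g → 𝔼 cs (λ ms → f ms + g ms) ≈ 𝔼 cs f + 𝔼 cs g
    𝔼-+ cs f g = trans (∑-cong (allMarksL cs) (λ ms → distribˡ (weightL q ms) (f ms) (g ms)))
                       (∑-+ (allMarksL cs) _ _)

    𝔼-*ˡ : ∀ cs a f → 𝔼 cs (λ ms → a * f ms) ≈ a * 𝔼 cs f
    𝔼-*ˡ cs a f = trans
      (∑-cong (allMarksL cs) (λ ms →
        solve 3 (λ w a x → w :* (a :* x) := a :* (w :* x)) refl (weightL q ms) a (f ms)))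
      (∑-*ˡ (allMarksL cs) a _)

    𝔼-∷ : ∀ l csc cs f → 𝔼 (node l csc ∷ cs) f
          ≈ p * 𝔼 csc (λ ms → 𝔼 cs (λ mss → f (node false ms ∷ mss)))
            + q * 𝔼 csc (λ ms → 𝔼 cs (λ mss → f (node true ms ∷ mss)))
    𝔼-∷ l csc cs f = begin
      𝔼 (node l csc ∷ cs) f
        ≈⟨ ∑-concatMap-map (allMarks (node l csc)) (allMarksL cs) _∷_ _ ⟩
      ∑[ m ∈ allMarks (node l csc) ] ∑[ mss ∈ allMarksL cs ] (weightL q (m ∷ mss) * f (m ∷ mss))
        ≈⟨ ∑-concatMap-map (false ∷ true ∷ []) (allMarksL csc) node _ ⟩
      marked false + (marked true + 0#)
        ≈⟨ +-cong (factor p false) (+-congʳ (factor q true)) ⟩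
      p * 𝔼 csc (λ ms → 𝔼 cs (λ mss → f (node false ms ∷ mss)))
        + (q * 𝔼 csc (λ ms → 𝔼 cs (λ mss → f (node true ms ∷ mss))) + 0#)
        ≈⟨ +-congˡ (+-identityʳ _) ⟩
      p * 𝔼 csc (λ ms → 𝔼 cs (λ mss → f (node false ms ∷ mss)))
        + q * 𝔼 csc (λ ms → 𝔼 cs (λ mss → f (node true ms ∷ mss))) ∎
      where
      marked : Bool → Carrier
      marked b = ∑[ ms ∈ allMarksL csc ] ∑[ mss ∈ allMarksL cs ]
                   (weightL q (node b ms ∷ mss) * f (node b ms ∷ mss))
      factor : ∀ a b →
               ∑[ ms ∈ allMarksL csc ] ∑[ mss ∈ allMarksL cs ] ((a * (weightL q ms * weightL q mss)) * f (node b ms ∷ mss))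
                 ≈ a * 𝔼 csc (λ ms → 𝔼 cs (λ mss → f (node b ms ∷ mss)))
      factor a b = trans
        (∑-cong (allMarksL csc) (λ ms → trans
          (∑-cong (allMarksL cs) (λ mss →
            solve 4 (λ a x y z → (a :* (x :* y)) :* z := (a :* x) :* (y :* z)) refl a _ _ _))
          (trans (∑-*ˡ (allMarksL cs) _ _) (*-assoc a _ _))))
        (∑-*ˡ (allMarksL csc) a _)

    𝔼-const : ∀ cs a → 𝔼 cs (λ _ → a) ≈ a
    𝔼-const []                a = trans (+-identityʳ _) (*-identityˡ a)
    𝔼-const (node l csc ∷ cs) a = begin
      𝔼 (node l csc ∷ cs) (λ _ → a)
        ≈⟨ 𝔼-∷ l csc cs _ ⟩
      p * 𝔼 csc (λ _ → 𝔼 cs (λ _ → a)) + q * 𝔼 csc (λ _ → 𝔼 cs (λ _ → a))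
        ≈⟨ +-cong (*-congˡ nested) (*-congˡ nested) ⟩
      p * a + q * a
        ≈⟨ sym (distribʳ a p q) ⟩
      (p + q) * a
        ≈⟨ trans (*-congʳ p+q≈1) (*-identityˡ a) ⟩
      a ∎
      where
      nested : 𝔼 csc (λ _ → 𝔼 cs (λ _ → a)) ≈ a
      nested = trans (𝔼-cong csc (λ _ → 𝔼-const cs a)) (𝔼-const csc a)

    E-node : ∀ l cs f → E q (node l cs) f ≡ 𝔼 cs (λ ms → f (node l (traceL cs ms)))
    E-node l cs f = ∑-map (allMarksL cs) (node false) _

    E-cong : ∀ X (f g : Tree → Carrier) → (∀ m → f (trace X m) ≈ g (trace X m)) → E q X f ≈ E q X g
    E-cong X f g e = ∑-cong (markings X) (λ m → *-congˡ (e m))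

    φ : Carrier → Carrier
    φ u = p * u + q

    module _ (k : ℕ) where

      mutual
        horner-expect : ∀ ℓ {d X} → IsComplete k d X → (us : Vec Carrier ℓ) →
                        E q X (λ T → horner ℓ rootBit (augment k d T) us) ≈ pow p ℓ * horner ℓ rootBit X (V.map φ us)
        horner-expect zero {d} {node l cs} _ [] = begin
          E q (node l cs) (λ T → rootBit (augment k d T))
            ≡⟨ E-node l cs (λ T → rootBit (augment k d T)) ⟩
          𝔼 cs (λ ms → rootBit (augment k d (node l (traceL cs ms))))
            ≈⟨ 𝔼-cong cs (λ ms → reflexive (≡.cong bit (root-augment k d l (traceL cs ms)))) ⟩
          𝔼 cs (λ _ → bit l)
            ≈⟨ trans (𝔼-const cs (bit l)) (sym (*-identityˡ (bit l))) ⟩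
          1# * bit l ∎
        horner-expect (suc ℓ) {zero} (leaf l) (u ∷ us) =
          trans (reflexive (E-node l [] (λ T → horner (suc ℓ) rootBit T (u ∷ us))))
                (trans (𝔼-const [] 0#) (sym (zeroʳ _)))
        horner-expect (suc ℓ) {suc d} {node l cs} (inner _ cc) (u ∷ us) = begin
          E q (node l cs) (λ T → horner (suc ℓ) rootBit (augment k (suc d) T) (u ∷ us))
            ≡⟨ E-node l cs (λ T → horner (suc ℓ) rootBit (augment k (suc d) T) (u ∷ us)) ⟩
          𝔼 cs (λ ms → hornerL ℓ rootBit (augmentL k d (traceL cs ms) ++ replicate (k ∸ length (traceL cs ms)) (zeroTree k d)) u us)
            ≈⟨ 𝔼-cong cs (λ ms → hornerL-padding k ℓ d (augmentL k d (traceL cs ms)) _ u us) ⟩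
          𝔼 cs (λ ms → hornerL ℓ rootBit (augmentL k d (traceL cs ms)) u us)
            ≈⟨ hornerL-expect ℓ cc u us ⟩
          pow p (suc ℓ) * horner (suc ℓ) rootBit (node l cs) (V.map φ (u ∷ us)) ∎

        hornerL-expect : ∀ ℓ {d cs} → All (IsComplete k d) cs → ∀ u (us : Vec Carrier ℓ) →
                         𝔼 cs (λ ms → hornerL ℓ rootBit (augmentL k d (traceL cs ms)) u us)
                           ≈ pow p (suc ℓ) * hornerL ℓ rootBit cs (φ u) (V.map φ us)
        hornerL-expect ℓ [] u us = trans (𝔼-const [] 0#) (sym (zeroʳ _))
        hornerL-expect ℓ {d} {node lc csc ∷ cs} (cc ∷ ccs) u us = begin
          𝔼 (node lc csc ∷ cs) (λ ms → hornerL ℓ rootBit (augmentL k d (traceL (node lc csc ∷ cs) ms)) u us)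
            ≈⟨ 𝔼-∷ lc csc cs _ ⟩
          p * 𝔼 csc (λ ms → 𝔼 cs (λ mss → survivor ms + u * rest mss)) + q * 𝔼 csc (λ _ → 𝔼 cs rest)
            ≈⟨ +-cong (*-congˡ (𝔼-cong csc kept)) (*-congˡ (trans (𝔼-cong csc (λ _ → recursion)) (𝔼-const csc Rest))) ⟩
          p * 𝔼 csc (λ ms → survivor ms + u * Rest) + q * Rest
            ≈⟨ +-congʳ (*-congˡ (trans (𝔼-+ csc _ _) (+-cong first-child (𝔼-const csc _)))) ⟩
          p * (pow p ℓ * H + u * Rest) + q * Rest
            ≈⟨ solve 6 (λ p P H u G q → p :* (P :* H :+ u :* ((p :* P) :* G)) :+ q :* ((p :* P) :* G)
                                      := (p :* P) :* (H :+ (p :* u :+ q) :* G))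
                     refl p (pow p ℓ) H u (hornerL ℓ rootBit cs (φ u) (V.map φ us)) q ⟩
          pow p (suc ℓ) * hornerL ℓ rootBit (node lc csc ∷ cs) (φ u) (V.map φ us) ∎
          where
          survivor : List Tree → Carrier
          survivor ms = horner ℓ rootBit (augment k d (node lc (traceL csc ms))) us
          rest : List Tree → Carrier
          rest mss = hornerL ℓ rootBit (augmentL k d (traceL cs mss)) u us
          H Rest : Carrier
          H = horner ℓ rootBit (node lc csc) (V.map φ us)
          Rest = pow p (suc ℓ) * hornerL ℓ rootBit cs (φ u) (V.map φ us)
          recursion : 𝔼 cs rest ≈ Rest
          recursion = hornerL-expect ℓ ccs u us
          kept : ∀ ms → 𝔼 cs (λ mss → survivor ms + u * rest mss) ≈ survivor ms + u * Rest
          kept ms = trans (𝔼-+ cs _ _)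
                          (+-cong (𝔼-const cs _) (trans (𝔼-*ˡ cs u rest) (*-congˡ recursion)))
          first-child : 𝔼 csc survivor ≈ pow p ℓ * H
          first-child = trans (reflexive (≡.sym (E-node lc csc (λ T → horner ℓ rootBit (augment k d T) us))))
                              (horner-expect ℓ cc us)

lemma6 : ∀ {c r} (R : CommutativeRing c r) →
             let open CommutativeRing R in let open WithRing R in
             (k d : ℕ) (X : Tree) → IsComplete k d X → (q : Carrier) →
             (ℓ : ℕ) → 1 ≤ ℓ → ℓ ≤ d → (w : Vec Carrier ℓ) →
             E q X (λ T → Apoly k ℓ (augment k d T) w)
               ≈ pow (1# - q) ℓ * sumR (map (λ t → bit (lab X ℓ (index t)) * monoWith (λ x → (1# - q) * x + q) w t) (tuples k ℓ))
-- The identity also holds for ℓ = 0.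
lemma6 R k d X cX q ℓ _ ℓ≤d w = begin
  E q X (λ T → Apoly k ℓ (augment k d T) w)
    ≈⟨ E-cong q X (λ T → Apoly k ℓ (augment k d T) w) (λ T → horner ℓ rootBit (augment k d T) (reverse w))
                (λ m → Apoly≈horner k ℓ _ w (saturated-≤ ℓ≤d (augment-saturated (trace-bounded m cX)))) ⟩
  E q X (λ T → horner ℓ rootBit (augment k d T) (reverse w))
    ≈⟨ horner-expect q k ℓ cX (reverse w) ⟩
  pow (p q) ℓ * horner ℓ rootBit X (V.map (φ q) (reverse w))
    ≡⟨ ≡.cong (λ v → pow (p q) ℓ * horner ℓ rootBit X v) (map-reverse (φ q) w) ⟩
  pow (p q) ℓ * horner ℓ rootBit X (reverse (V.map (φ q) w))
    ≈⟨ *-congˡ (sym (Apoly≈horner k ℓ X (V.map (φ q) w) (saturated-≤ ℓ≤d (complete⇒saturated cX)))) ⟩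
  pow (p q) ℓ * Apoly k ℓ X (V.map (φ q) w)
    ≈⟨ *-congˡ (∑-cong (tuples k ℓ) (λ t → reflexive (≡.cong (bit (lab X ℓ (index t)) *_)
                                                            (≡.sym (monoWith-map (φ q) w t))))) ⟩
  pow (1# - q) ℓ * sumR (map (λ t → bit (lab X ℓ (index t)) * monoWith (λ x → (1# - q) * x + q) w t) (tuples k ℓ)) ∎
  where
  open CommutativeRing R
  open WithRing R
  open Evaluation R
  open import Relation.Binary.Reasoning.Setoid setoid
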